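{- Let $n\geq 3$ and consider $\texttt{REL}(\mathbb{Z}_n\times\mathbb{Z}_4,\{(1,0),(0,1)\})$. Player 1 has a winning strategy if $n\equiv \pm 1\pmod 4$. Player 2 has a winning strategy if $n\equiv 0\pmod 4$ or $n\equiv 2\pmod 4$.
   Context: Game $\texttt{REL}(G,S)$: $G$ is a finite group and $S$ a generating set with $e\notin S$. Two players alternate turns, Player 1 first, starting from the empty word $w_0$. On turn $n$ the current player chooses $s_n\in S\cup S^{ -1}$, subject to $s_n\neq s_{n-1}^{ -1}$ when $n>1$, and forms $w_n=w_{n-1}s_n$. If $w_n$ represents the same element of $G$ as some $w_k$ with $0\le k<n$, the player who formed $w_n$ wins. If a player has no legal move, that player loses. -}

module Defs where

open import Data.Nat using (ℕ; zero; suc; _+_; _∸_; NonZero)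
open import Data.Nat.DivMod using (_mod_)
open import Data.Fin using (Fin; toℕ)
open import Data.Product using (_×_; _,_; Σ)
open import Data.Sum using (_⊎_)
open import Data.Maybe using (Maybe; just; nothing)
open import Data.Unit using (⊤)
open import Data.List using (List; []; _∷_)
open import Data.List.Membership.Propositional using (_∈_)
open import Relation.Nullary using (¬_)
open import Relation.Binary.PropositionalEquality using (_≡_)

-- The game REL(G,S), for a group given by its operations
-- (carrier, multiplication, inverse, identity) and a list S of generators.
-- Words are tracked by the group element they represent.

record GroupData : Set₁ where
  field
    El   : Set
    _·_  : El → El → El
    inv  : El → El
    e    : El
    S    : List El

module REL (G : GroupData) where
  open GroupData G

  SymGen : El → Set
  SymGen s = (s ∈ S) ⊎ (inv s ∈ S)

  Move : Set
  Move = Σ El SymGen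

  elt : Move → El
  elt (s , _) = s

  Legal : Maybe Move → Move → Set
  Legal nothing     s = ⊤
  Legal (just prev) s = ¬ (elt s ≡ inv (elt prev))

  -- A position: `past` is the list of elements w_0,…,w_{n-1} (most recent
  -- first, so its head is the current word w_{n-1} = w), `last` the last move.
  -- Wins past w last  : the player about to move has a winning strategy.
  -- Loses past w last : the player about to move loses against a suitable
  --                     strategy of the opponent (the opponent has a
  --                     winning strategy).
  data Wins  (past : List El) (w : El) (last : Maybe Move) : Set
  data Loses (past : List El) (w : El) (last : Maybe Move) : Set

  data Wins past w last where
    win-now   : (s : Move) → Legal last s → (w · elt s) ∈ past → Wins past w last
    win-later : (s : Move) → Legal last s → ¬ ((w · elt s) ∈ past) →
                Loses ((w · elt s) ∷ past) (w · elt s) (just s) → Wins past w last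

  data Loses past w last where
    lose : ((s : Move) → Legal last s →
              (¬ ((w · elt s) ∈ past)) ×
              Wins ((w · elt s) ∷ past) (w · elt s) (just s)) →
           Loses past w last

  Player1Wins : Set
  Player1Wins = Wins (e ∷ []) e nothing

  Player2Wins : Set
  Player2Wins = Loses (e ∷ []) e nothing

module _ {k : ℕ} {{_ : NonZero k}} where
  _+ₖ_ : Fin k → Fin k → Fin k
  a +ₖ b = (toℕ a + toℕ b) mod k

  -ₖ_ : Fin k → Fin k
  -ₖ a = (k ∸ toℕ a) mod k

  0ₖ 1ₖ : Fin k
  0ₖ = 0 mod k
  1ₖ = 1 mod k

Zn×Z4 : (n : ℕ) {{_ : NonZero n}} → GroupData
Zn×Z4 n = record
  { El  = Fin n × Fin 4
  ; _·_ = λ { (a , b) (c , d) → (a +ₖ c , b +ₖ d) }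
  ; inv = λ { (a , b) → (-ₖ a , -ₖ b) }
  ; e   = (0ₖ , 0ₖ)
  ; S   = (1ₖ , 0ₖ) ∷ (0ₖ , 1ₖ) ∷ []
  }

module Submission where

-- Write an element of ℤ_n × ℤ_4 as a cell (column, level).
--
-- n even: reducing both coordinates mod 2 is a homomorphism χ onto ℤ_2 × ℤ_2 that separates the
-- two generators. Player 2 repeats every move of Player 1, so after each of her moves the word has
-- colour 0. A move s of Player 1 cannot close a relation: the element reached has colour χ(s), so
-- it was reached before only by a move s^±1 of Player 1 from an earlier colour-0 word, and then
-- either that word or Player 2's answer to it equals the current word, which was new when reached
-- (or s undoes the previous move).
--
-- n odd: Player 1 moves horizontally unless some move wins at once. Player 2 then always stands on
-- a cell whose column and level have different parity, so the first lap around the columns changes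
-- level only from such cells. As n is odd, the walk re-enters column 0 at an odd level, from where
-- Player 1 steps back to the start, or at level 0, which is the start, or at level 2. On the second
-- lap, along level 2, Player 1 answers a vertical move by a second one onto the first lap, which
-- stays at level 0 in the columns reached: at an even column the parity rule keeps it there, and
-- were it to leave level 0 at an odd column, Player 1 would step onto it. The first lap ends at
-- level 2, so this cannot go on all the way round.

open import Defs
open import Data.Nat using (ℕ; zero; suc; _+_; _*_; _∸_; _≤_; _<_; _≤?_; NonZero; z≤n; s≤s)
open import Data.Nat.Properties
open import Data.Nat.DivMod using (_%_; _/_; m<n⇒m%n≡m; n%n≡0; m≡m%n+[m/n]*n; %-distribˡ-+; [m+n]%n≡m%n)
open import Data.Nat.Base using (parity; >-nonZero⁻¹)
open import Data.Parity.Base as ℙ using (Parity; 0ℙ; 1ℙ)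
import Data.Parity.Properties as ℙ
open import Data.Fin using (Fin; toℕ)
open import Data.Fin.Patterns using (0F; 1F; 2F; 3F)
open import Data.Fin.Properties using (toℕ-fromℕ<; toℕ-injective; toℕ<n) renaming (_≟_ to _≟ᶠ_)
open import Data.Product using (_×_; _,_; Σ; proj₁; proj₂)
open import Data.Product.Properties using (≡-dec)
open import Data.Sum using (_⊎_; inj₁; inj₂)
open import Data.Maybe using (Maybe; just; nothing)
open import Data.List using (List; []; _∷_; cartesianProduct; allFin)
open import Data.List.Membership.Propositional using (_∈_; _∉_)
open import Data.List.Membership.Propositional.Properties using (∈-cartesianProduct⁺; ∈-allFin)
open import Data.List.Relation.Unary.Any using (here; there)
open import Data.Empty using (⊥; ⊥-elim)
open import Relation.Nullary using (Dec; yes; no)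
open import Relation.Binary.Definitions using (DecidableEquality; tri<; tri≈; tri>)
open import Relation.Binary.PropositionalEquality

module _ {k : ℕ} {{_ : NonZero k}} where

  toℕ-+ₖ : (a b : Fin k) → toℕ (a +ₖ b) ≡ (toℕ a + toℕ b) % k
  toℕ-+ₖ a b = toℕ-fromℕ< _

  toℕ--ₖ : (a : Fin k) → toℕ (-ₖ a) ≡ (k ∸ toℕ a) % k
  toℕ--ₖ a = toℕ-fromℕ< _

  toℕ-0ₖ : toℕ (0ₖ {k}) ≡ 0
  toℕ-0ₖ = trans (toℕ-fromℕ< _) (m<n⇒m%n≡m (>-nonZero⁻¹ k))

  toℕ-1ₖ : 1 < k → toℕ (1ₖ {k}) ≡ 1
  toℕ-1ₖ 1<k = trans (toℕ-fromℕ< _) (m<n⇒m%n≡m 1<k)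

  toℕ--ₖ0ₖ : toℕ (-ₖ (0ₖ {k})) ≡ 0
  toℕ--ₖ0ₖ = begin
    toℕ (-ₖ 0ₖ)          ≡⟨ toℕ--ₖ 0ₖ ⟩
    (k ∸ toℕ (0ₖ {k})) % k ≡⟨ cong (λ z → (k ∸ z) % k) toℕ-0ₖ ⟩
    k % k                ≡⟨ n%n≡0 k ⟩
    0                    ∎
    where open ≡-Reasoning

  toℕ-+ₖ-zero : (a z : Fin k) → toℕ z ≡ 0 → toℕ (a +ₖ z) ≡ toℕ a
  toℕ-+ₖ-zero a z z≡0 = begin
    toℕ (a +ₖ z)          ≡⟨ toℕ-+ₖ a z ⟩
    (toℕ a + toℕ z) % k   ≡⟨ cong (λ m → (toℕ a + m) % k) z≡0 ⟩
    (toℕ a + 0) % k       ≡⟨ cong (_% k) (+-identityʳ (toℕ a)) ⟩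
    toℕ a % k             ≡⟨ m<n⇒m%n≡m (toℕ<n a) ⟩
    toℕ a                 ∎
    where open ≡-Reasoning

  -ₖ-involutive : (a : Fin k) → -ₖ (-ₖ a) ≡ a
  -ₖ-involutive a = toℕ-injective (begin
    toℕ (-ₖ (-ₖ a))            ≡⟨ toℕ--ₖ (-ₖ a) ⟩
    (k ∸ toℕ (-ₖ a)) % k       ≡⟨ cong (λ z → (k ∸ z) % k) (toℕ--ₖ a) ⟩
    (k ∸ (k ∸ toℕ a) % k) % k  ≡⟨ k∸[k∸m]%k (toℕ a) (toℕ<n a) ⟩
    toℕ a                      ∎)
    where
    open ≡-Reasoning
    k∸[k∸m]%k : ∀ m → m < k → (k ∸ (k ∸ m) % k) % k ≡ m
    k∸[k∸m]%k zero _ = begin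
      (k ∸ k % k) % k ≡⟨ cong (λ z → (k ∸ z) % k) (n%n≡0 k) ⟩
      k % k           ≡⟨ n%n≡0 k ⟩
      0               ∎
    k∸[k∸m]%k (suc m) m<k = begin
      (k ∸ (k ∸ suc m) % k) % k ≡⟨ cong (λ z → (k ∸ z) % k) (m<n⇒m%n≡m (∸-monoʳ-< (s≤s z≤n) (<⇒≤ m<k))) ⟩
      (k ∸ (k ∸ suc m)) % k     ≡⟨ cong (_% k) (m∸[m∸n]≡n (<⇒≤ m<k)) ⟩
      suc m % k                 ≡⟨ m<n⇒m%n≡m m<k ⟩
      suc m                     ∎

  a+b-b≡a : (a b : Fin k) → (a +ₖ b) +ₖ (-ₖ b) ≡ a
  a+b-b≡a a b = toℕ-injective (begin
    toℕ ((a +ₖ b) +ₖ (-ₖ b))                   ≡⟨ toℕ-+ₖ (a +ₖ b) (-ₖ b) ⟩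
    (toℕ (a +ₖ b) + toℕ (-ₖ b)) % k            ≡⟨ cong₂ (λ x y → (x + y) % k) (toℕ-+ₖ a b) (toℕ--ₖ b) ⟩
    ((toℕ a + toℕ b) % k + (k ∸ toℕ b) % k) % k ≡⟨ %-distribˡ-+ (toℕ a + toℕ b) (k ∸ toℕ b) k ⟨
    (toℕ a + toℕ b + (k ∸ toℕ b)) % k          ≡⟨ cong (_% k) (+-assoc (toℕ a) (toℕ b) (k ∸ toℕ b)) ⟩
    (toℕ a + (toℕ b + (k ∸ toℕ b))) % k        ≡⟨ cong (λ z → (toℕ a + z) % k) (m+[n∸m]≡n (<⇒≤ (toℕ<n b))) ⟩
    (toℕ a + k) % k                            ≡⟨ [m+n]%n≡m%n (toℕ a) k ⟩
    toℕ a % k                                  ≡⟨ m<n⇒m%n≡m (toℕ<n a) ⟩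
    toℕ a                                      ∎)
    where open ≡-Reasoning

  parity-% : parity k ≡ 0ℙ → (m : ℕ) → parity (m % k) ≡ parity m
  parity-% k-even m = sym (begin
    parity m                                      ≡⟨ cong parity (m≡m%n+[m/n]*n m k) ⟩
    parity (m % k + m / k * k)                    ≡⟨ ℙ.+-homo-+ (m % k) (m / k * k) ⟩
    parity (m % k) ℙ.+ parity (m / k * k)         ≡⟨ cong (parity (m % k) ℙ.+_) (ℙ.*-homo-* (m / k) k) ⟩
    parity (m % k) ℙ.+ (parity (m / k) ℙ.* parity k)
      ≡⟨ cong (λ p → parity (m % k) ℙ.+ (parity (m / k) ℙ.* p)) k-even ⟩
    parity (m % k) ℙ.+ (parity (m / k) ℙ.* 0ℙ)    ≡⟨ cong (parity (m % k) ℙ.+_) (ℙ.*-zeroʳ (parity (m / k))) ⟩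
    parity (m % k) ℙ.+ 0ℙ                         ≡⟨ ℙ.+-identityʳ (parity (m % k)) ⟩
    parity (m % k)                                ∎)
    where open ≡-Reasoning

  parity-+ₖ : parity k ≡ 0ℙ → (a b : Fin k) → parity (toℕ (a +ₖ b)) ≡ parity (toℕ a) ℙ.+ parity (toℕ b)
  parity-+ₖ k-even a b = begin
    parity (toℕ (a +ₖ b))             ≡⟨ cong parity (toℕ-+ₖ a b) ⟩
    parity ((toℕ a + toℕ b) % k)      ≡⟨ parity-% k-even (toℕ a + toℕ b) ⟩
    parity (toℕ a + toℕ b)            ≡⟨ ℙ.+-homo-+ (toℕ a) (toℕ b) ⟩
    parity (toℕ a) ℙ.+ parity (toℕ b) ∎
    where open ≡-Reasoning

module _ (G : GroupData) where
  open GroupData G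
  open REL G

  module Play (_≟_ : DecidableEquality El) where
    open import Data.List.Membership.DecPropositional _≟_ using (_∈?_)

    winsNow-or-fresh : ∀ {past x last} (s : Move) →
                       Wins past x last ⊎ (Legal last s → x · elt s ∉ past)
    winsNow-or-fresh {past} {x} {nothing} s with (x · elt s) ∈? past
    ... | yes hit = inj₁ (win-now s _ hit)
    ... | no miss = inj₂ (λ _ → miss)
    winsNow-or-fresh {past} {x} {just prev} s with elt s ≟ inv (elt prev) | (x · elt s) ∈? past
    ... | yes illegal | _      = inj₂ (λ legal → ⊥-elim (legal illegal))
    ... | no legal    | yes hit = inj₁ (win-now s legal hit)
    ... | no _        | no miss = inj₂ (λ _ → miss)

    -- Opaque, so that `with visited? a (x ∷ past)` can abstract it before it unfolds.
    opaque
      visited? : (a : El) (past : List El) → Dec (a ∈ past)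
      visited? = _∈?_

    unvisited : List El → List El → ℕ
    unvisited past [] = 0
    unvisited past (a ∷ as) with visited? a past
    ... | yes _ = unvisited past as
    ... | no _  = suc (unvisited past as)

    unvisited-∷-≤ : ∀ x past as → unvisited (x ∷ past) as ≤ unvisited past as
    unvisited-∷-≤ x past [] = z≤n
    unvisited-∷-≤ x past (a ∷ as) with visited? a (x ∷ past) | visited? a past
    ... | yes _ | yes _  = unvisited-∷-≤ x past as
    ... | yes _ | no _   = m≤n⇒m≤1+n (unvisited-∷-≤ x past as)
    ... | no a∉ | yes a∈ = ⊥-elim (a∉ (there a∈))
    ... | no _  | no _   = s≤s (unvisited-∷-≤ x past as)

    unvisited-∷-< : ∀ {x past as} → x ∉ past → x ∈ as → unvisited (x ∷ past) as < unvisited past as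
    unvisited-∷-< {x} {past} {a ∷ as} x∉ (here refl) with visited? a (x ∷ past) | visited? a past
    ... | _     | yes a∈ = ⊥-elim (x∉ a∈)
    ... | no a∉ | no _   = ⊥-elim (a∉ (here refl))
    ... | yes _ | no _   = s≤s (unvisited-∷-≤ x past as)
    unvisited-∷-< {x} {past} {a ∷ as} x∉ (there x∈) with visited? a (x ∷ past) | visited? a past
    ... | yes _ | yes _  = unvisited-∷-< x∉ x∈
    ... | yes _ | no _   = m<n⇒m<1+n (unvisited-∷-< x∉ x∈)
    ... | no a∉ | yes a∈ = ⊥-elim (a∉ (there a∈))
    ... | no _  | no _   = s≤s (unvisited-∷-< x∉ x∈)

  -- The mirror strategy

  module Mirror
    (_≟_ : DecidableEquality El)
    (elements : List El) (∈-elements : ∀ v → v ∈ elements)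
    (inv-involutive : ∀ v → inv (inv v) ≡ v)
    (·-inv-cancel : ∀ v s → (v · s) · inv s ≡ v)
    {C : Set} (_⊕_ : C → C → C) (o : C)
    (⊕-identityˡ : ∀ a → o ⊕ a ≡ a) (⊕-cancelʳ : ∀ a b → (a ⊕ b) ⊕ b ≡ a)
    (χ : El → C) (χ-e : χ e ≡ o) (χ-· : ∀ v s → χ (v · s) ≡ χ v ⊕ χ s)
    (χ-gen≢o : ∀ {s} → s ∈ S → χ s ≢ o)
    (χ-gen-injective : ∀ {s s′} → s ∈ S → s′ ∈ S → χ s ≡ χ s′ → s ≡ s′)
    (gen≢gen⁻¹ : ∀ {s} → s ∈ S → s ≢ inv s)
    where

    open Play _≟_
    open import Data.List.Membership.DecPropositional _≟_ using (_∈?_)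

    ·-cancelʳ : ∀ {v w} s → v · s ≡ w · s → v ≡ w
    ·-cancelʳ {v} {w} s eq = begin
      v                ≡⟨ ·-inv-cancel v s ⟨
      (v · s) · inv s  ≡⟨ cong (_· inv s) eq ⟩
      (w · s) · inv s  ≡⟨ ·-inv-cancel w s ⟩
      w                ∎
      where open ≡-Reasoning

    χ-inv : ∀ s → χ (inv s) ≡ χ s
    χ-inv s = sym (begin
      χ s                           ≡⟨ ⊕-cancelʳ (χ s) (χ (inv s)) ⟨
      (χ s ⊕ χ (inv s)) ⊕ χ (inv s) ≡⟨ cong (_⊕ χ (inv s)) χs⊕χs⁻¹≡o ⟩
      o ⊕ χ (inv s)                 ≡⟨ ⊕-identityˡ (χ (inv s)) ⟩
      χ (inv s)                     ∎)
      where
      open ≡-Reasoning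
      χs⊕χs⁻¹≡o : χ s ⊕ χ (inv s) ≡ o
      χs⊕χs⁻¹≡o = begin
        χ s ⊕ χ (inv s)         ≡⟨ cong (_⊕ χ (inv s)) (⊕-identityˡ (χ s)) ⟨
        (o ⊕ χ s) ⊕ χ (inv s)   ≡⟨ cong (λ a → (a ⊕ χ s) ⊕ χ (inv s)) χ-e ⟨
        (χ e ⊕ χ s) ⊕ χ (inv s) ≡⟨ cong (_⊕ χ (inv s)) (χ-· e s) ⟨
        χ (e · s) ⊕ χ (inv s)   ≡⟨ χ-· (e · s) (inv s) ⟨
        χ ((e · s) · inv s)     ≡⟨ cong χ (·-inv-cancel e s) ⟩
        χ e                     ≡⟨ χ-e ⟩
        o                       ∎

    χ-o· : ∀ {v} s → χ v ≡ o → χ (v · s) ≡ χ s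
    χ-o· {v} s χv≡o = trans (χ-· v s) (trans (cong (_⊕ χ s) χv≡o) (⊕-identityˡ (χ s)))

    generator : (t : Move) → Σ El λ s → s ∈ S × (elt t ≡ s ⊎ elt t ≡ inv s)
    generator (s , inj₁ s∈S)  = s , s∈S , inj₁ refl
    generator (s , inj₂ s⁻¹∈S) = inv s , s⁻¹∈S , inj₂ (sym (inv-involutive s))

    χ-± : ∀ {x s} → x ≡ s ⊎ x ≡ inv s → χ x ≡ χ s
    χ-± (inj₁ refl) = refl
    χ-± (inj₂ refl) = χ-inv _

    χ-move≢o : (t : Move) → χ (elt t) ≢ o
    χ-move≢o t with generator t
    ... | s , s∈S , t≡s± = λ χt≡o → χ-gen≢o s∈S (trans (sym (χ-± t≡s±)) χt≡o)

    χ-move-injective : (u t : Move) → χ (elt u) ≡ χ (elt t) → elt u ≡ elt t ⊎ elt u ≡ inv (elt t)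
    χ-move-injective u t χu≡χt with generator u | generator t
    ... | s , s∈S , u≡s± | s′ , s′∈S , t≡s′±
      with χ-gen-injective s∈S s′∈S (trans (sym (χ-± u≡s±)) (trans χu≡χt (χ-± t≡s′±)))
    ... | refl with u≡s± | t≡s′±
    ...   | inj₁ u≡s | inj₁ t≡s = inj₁ (trans u≡s (sym t≡s))
    ...   | inj₁ u≡s | inj₂ t≡s⁻¹ = inj₂ (trans u≡s (trans (sym (inv-involutive s)) (cong inv (sym t≡s⁻¹))))
    ...   | inj₂ u≡s⁻¹ | inj₁ t≡s = inj₂ (trans u≡s⁻¹ (cong inv (sym t≡s)))
    ...   | inj₂ u≡s⁻¹ | inj₂ t≡s⁻¹ = inj₁ (trans u≡s⁻¹ (sym t≡s⁻¹))

    repeat-legal : (t : Move) → Legal (just t) t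
    repeat-legal t with generator t
    ... | s , s∈S , inj₁ refl = gen≢gen⁻¹ s∈S
    ... | s , s∈S , inj₂ refl = λ s⁻¹≡s⁻¹⁻¹ →
            gen≢gen⁻¹ s∈S (trans (sym (inv-involutive s)) (trans (cong inv s⁻¹≡s⁻¹⁻¹) (inv-involutive (inv s))))

    -- Player 1 reached x by the move `move` from `base`, and Player 2 has answered with `move` again.
    record Mirrored (earlier : List El) (E : El) (last : Maybe Move) (x : El) : Set where
      field
        base       : El
        move       : Move
        x≡base·move : x ≡ base · elt move
        χ-base     : χ base ≡ o
        base∈      : base ∈ earlier
        next       : x · elt move ∈ earlier ⊎ (x · elt move ≡ E × last ≡ just move)

    record MirrorInvariant (earlier : List El) (E : El) (last : Maybe Move) : Set where
      field
        χ-E       : χ E ≡ o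
        E∉earlier : E ∉ earlier
        mirrored  : ∀ {x} → x ∈ E ∷ earlier → χ x ≢ o → Mirrored earlier E last x

    mirror-fresh : ∀ {earlier E last} → MirrorInvariant earlier E last →
                   (t : Move) → Legal last t → E · elt t ∉ E ∷ earlier
    mirror-fresh {earlier} {E} {last} I t legal x∈ = impossible
      where
      open MirrorInvariant I
      x = E · elt t
      χx≡χt : χ x ≡ χ (elt t)
      χx≡χt = χ-o· (elt t) χ-E
      M = mirrored x∈ (λ χx≡o → χ-move≢o t (trans (sym χx≡χt) χx≡o))
      open Mirrored M
      χx≡χu : χ x ≡ χ (elt move)
      χx≡χu = trans (cong χ x≡base·move) (χ-o· (elt move) χ-base)
      impossible : ⊥
      impossible with χ-move-injective move t (trans (sym χx≡χu) χx≡χt)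
      ... | inj₁ u≡t = E∉earlier (subst (_∈ earlier) base≡E base∈)
        where
        base≡E : base ≡ E
        base≡E = ·-cancelʳ (elt t) (trans (cong (base ·_) (sym u≡t)) (sym x≡base·move))
      ... | inj₂ u≡t⁻¹ with next
      ...   | inj₁ x·u∈ = E∉earlier (subst (_∈ earlier) x·u≡E x·u∈)
        where
        x·u≡E : x · elt move ≡ E
        x·u≡E = trans (cong (x ·_) u≡t⁻¹) (·-inv-cancel E (elt t))
      ...   | inj₂ (_ , last≡u) =
              subst (λ l → Legal l t) last≡u legal (trans (sym (inv-involutive (elt t))) (cong inv (sym u≡t⁻¹)))

    mirror-step : ∀ {earlier E last} → MirrorInvariant earlier E last → (t : Move) →
                  let y = E · elt t in y · elt t ∉ y ∷ E ∷ earlier →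
                  MirrorInvariant (y ∷ E ∷ earlier) (y · elt t) (just t)
    mirror-step {earlier} {E} {last} I t fresh = record
      { χ-E = χ-E′ ; E∉earlier = fresh ; mirrored = mirrored′ }
      where
      open MirrorInvariant I
      y = E · elt t
      χ-E′ : χ (y · elt t) ≡ o
      χ-E′ = begin
        χ (y · elt t)               ≡⟨ χ-· y (elt t) ⟩
        χ y ⊕ χ (elt t)             ≡⟨ cong (_⊕ χ (elt t)) (χ-· E (elt t)) ⟩
        (χ E ⊕ χ (elt t)) ⊕ χ (elt t) ≡⟨ ⊕-cancelʳ (χ E) (χ (elt t)) ⟩
        χ E                         ≡⟨ χ-E ⟩
        o                           ∎
        where open ≡-Reasoning
      mirrored′ : ∀ {x} → x ∈ (y · elt t) ∷ y ∷ E ∷ earlier → χ x ≢ o →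
                  Mirrored (y ∷ E ∷ earlier) (y · elt t) (just t) x
      mirrored′ (here refl) χx≢o = ⊥-elim (χx≢o χ-E′)
      mirrored′ (there (here refl)) _ = record
        { base = E ; move = t ; x≡base·move = refl ; χ-base = χ-E
        ; base∈ = there (here refl) ; next = inj₂ (refl , refl) }
      mirrored′ (there (there x∈)) χx≢o = record
        { base = base ; move = move ; x≡base·move = x≡base·move ; χ-base = χ-base
        ; base∈ = there (there base∈) ; next = next′ next }
        where
        open Mirrored (mirrored x∈ χx≢o)
        next′ : ∀ {z} → z ∈ earlier ⊎ (z ≡ E × last ≡ just move) →
                z ∈ y ∷ E ∷ earlier ⊎ (z ≡ y · elt t × just t ≡ just move)
        next′ (inj₁ z∈) = inj₁ (there (there z∈))
        next′ (inj₂ (refl , _)) = inj₁ (there (here refl))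

    mirror-loses : ∀ fuel {earlier E last} → unvisited (E ∷ earlier) elements < fuel →
                   MirrorInvariant earlier E last → Loses (E ∷ earlier) E last
    mirror-loses zero () _
    mirror-loses (suc fuel) {earlier} {E} {last} bound I =
      lose λ t legal → mirror-fresh I t legal , answer t legal
      where
      answer : (t : Move) → Legal last t → Wins ((E · elt t) ∷ E ∷ earlier) (E · elt t) (just t)
      answer t legal with ((E · elt t) · elt t) ∈? ((E · elt t) ∷ E ∷ earlier)
      ... | yes hit  = win-now t (repeat-legal t) hit
      ... | no fresh = win-later t (repeat-legal t) fresh (mirror-loses fuel bound′ (mirror-step I t fresh))
        where
        y = E · elt t
        bound′ : unvisited ((y · elt t) ∷ y ∷ E ∷ earlier) elements < fuel
        bound′ = ≤-<-trans (unvisited-∷-≤ (y · elt t) (y ∷ E ∷ earlier) elements)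
                   (<-≤-trans (unvisited-∷-< (mirror-fresh I t legal) (∈-elements y)) (≤-pred bound))

    player2-wins : Player2Wins
    player2-wins = mirror-loses (suc (unvisited (e ∷ []) elements)) ≤-refl record
      { χ-E = χ-e ; E∉earlier = λ () ; mirrored = λ { (here refl) χe≢o → ⊥-elim (χe≢o χ-e) } }

module Grid (n : ℕ) {{_ : NonZero n}} (n≥3 : 3 ≤ n) where
  open GroupData (Zn×Z4 n) public
  open REL (Zn×Z4 n) public

  1<n : 1 < n
  1<n = ≤-trans (s≤s (s≤s z≤n)) n≥3

  col : El → ℕ
  col v = toℕ (proj₁ v)

  lvl : El → Fin 4
  lvl = proj₂

  _≟ᴳ_ : DecidableEquality El
  _≟ᴳ_ = ≡-dec _≟ᶠ_ _≟ᶠ_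

  cell-≡ : ∀ {v w} → col v ≡ col w → lvl v ≡ lvl w → v ≡ w
  cell-≡ c≡ l≡ = cong₂ _,_ (toℕ-injective c≡) l≡

  inv-involutive : ∀ v → inv (inv v) ≡ v
  inv-involutive (a , b) = cong₂ _,_ (-ₖ-involutive a) (-ₖ-involutive b)

  ·-inv-cancel : ∀ v s → (v · s) · inv s ≡ v
  ·-inv-cancel (a , b) (c , d) = cong₂ _,_ (a+b-b≡a a c) (a+b-b≡a b d)

  horizontal : Move
  horizontal = (1ₖ , 0ₖ) , inj₁ (here refl)

  data Dir : Set where
    up down : Dir

  shift : Dir → Fin 4 → Fin 4
  shift up   k = k +ₖ 1ₖ
  shift down k = k +ₖ (-ₖ 1ₖ)

  vertical : Dir → Move
  vertical up   = (0ₖ , 1ₖ) , inj₁ (there (here refl))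
  vertical down = inv (0ₖ , 1ₖ) , inj₂ (there (here (inv-involutive (0ₖ , 1ₖ))))

  col-horizontal : ∀ v → col (v · elt horizontal) ≡ (col v + 1) % n
  col-horizontal v = trans (toℕ-+ₖ (proj₁ v) 1ₖ) (cong (λ m → (col v + m) % n) (toℕ-1ₖ 1<n))

  col-horizontal-< : ∀ v {c} → col v ≡ c → suc c < n → col (v · elt horizontal) ≡ suc c
  col-horizontal-< v refl c+1<n =
    trans (col-horizontal v) (trans (cong (_% n) (+-comm (col v) 1)) (m<n⇒m%n≡m c+1<n))

  col-horizontal-wrap : ∀ v {c} → col v ≡ c → suc c ≡ n → col (v · elt horizontal) ≡ 0
  col-horizontal-wrap v refl c+1≡n =
    trans (col-horizontal v) (trans (cong (_% n) (trans (+-comm (col v) 1) c+1≡n)) (n%n≡0 n))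

  lvl-horizontal : ∀ v → lvl (v · elt horizontal) ≡ lvl v
  lvl-horizontal v = toℕ-injective (toℕ-+ₖ-zero (lvl v) 0ₖ (toℕ-0ₖ {4}))

  col-vertical : ∀ d v → col (v · elt (vertical d)) ≡ col v
  col-vertical up   v = toℕ-+ₖ-zero (proj₁ v) 0ₖ toℕ-0ₖ
  col-vertical down v = toℕ-+ₖ-zero (proj₁ v) (-ₖ 0ₖ) toℕ--ₖ0ₖ

  lvl-vertical : ∀ d v → lvl (v · elt (vertical d)) ≡ shift d (lvl v)
  lvl-vertical up   v = refl
  lvl-vertical down v = refl

  col-horizontal⁻¹ : col (inv (elt horizontal)) ≡ n ∸ 1
  col-horizontal⁻¹ = trans (toℕ--ₖ 1ₖ) (trans (cong (λ m → (n ∸ m) % n) (toℕ-1ₖ 1<n))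
                       (m<n⇒m%n≡m (∸-monoʳ-< (s≤s z≤n) (<⇒≤ 1<n))))

  horizontal≢horizontal⁻¹ : elt horizontal ≢ inv (elt horizontal)
  horizontal≢horizontal⁻¹ h≡h⁻¹ = <-irrefl (sym n∸1≡1) (∸-monoˡ-≤ 1 n≥3)
    where
    n∸1≡1 : n ∸ 1 ≡ 1
    n∸1≡1 = trans (sym col-horizontal⁻¹) (trans (sym (cong col h≡h⁻¹)) (toℕ-1ₖ 1<n))

  legal-after : ∀ {x} t s → elt t ≡ x → elt s ≢ inv x → Legal (just t) s
  legal-after t s refl s≢x⁻¹ = s≢x⁻¹

  horizontal≢vertical⁻¹ : ∀ d → elt horizontal ≢ inv (elt (vertical d))
  horizontal≢vertical⁻¹ up   h≡v⁻¹ with cong lvl h≡v⁻¹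
  ... | ()
  horizontal≢vertical⁻¹ down h≡v⁻¹ with cong lvl h≡v⁻¹
  ... | ()

  vertical≢horizontal⁻¹ : ∀ d → elt (vertical d) ≢ inv (elt horizontal)
  vertical≢horizontal⁻¹ up   v≡h⁻¹ with cong lvl v≡h⁻¹
  ... | ()
  vertical≢horizontal⁻¹ down v≡h⁻¹ with cong lvl v≡h⁻¹
  ... | ()

  vertical≢vertical⁻¹ : ∀ d → elt (vertical d) ≢ inv (elt (vertical d))
  vertical≢vertical⁻¹ up   v≡v⁻¹ with cong lvl v≡v⁻¹
  ... | ()
  vertical≢vertical⁻¹ down v≡v⁻¹ with cong lvl v≡v⁻¹
  ... | ()

  Refuted : List El → El → Move → Set
  Refuted past w t = (w · elt t ∉ past) × Wins ((w · elt t) ∷ past) (w · elt t) (just t)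

  data AfterHorizontal (t : Move) : Set where
    again : elt t ≡ elt horizontal → AfterHorizontal t
    turn  : ∀ d → elt t ≡ elt (vertical d) → AfterHorizontal t

  after-horizontal : (t : Move) → Legal (just horizontal) t → AfterHorizontal t
  after-horizontal (s , inj₁ (here refl))         _ = again refl
  after-horizontal (s , inj₁ (there (here refl))) _ = turn up refl
  after-horizontal (s , inj₂ (here s⁻¹≡h)) legal =
    ⊥-elim (legal (trans (sym (inv-involutive s)) (cong inv s⁻¹≡h)))
  after-horizontal (s , inj₂ (there (here s⁻¹≡v))) _ =
    turn down (trans (sym (inv-involutive s)) (cong inv s⁻¹≡v))

  record Traces (P : ℕ → Fin 4 → Set) (past : List El) : Set where
    field
      sound    : ∀ {v} → v ∈ past → P (col v) (lvl v)
      complete : ∀ {v} → P (col v) (lvl v) → v ∈ past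

  Traces-resp : ∀ {P Q past} → (∀ {c k} → P c k → Q c k) → (∀ {c k} → Q c k → P c k) →
                Traces P past → Traces Q past
  Traces-resp P⊆Q Q⊆P T = record { sound = λ v∈ → P⊆Q (sound v∈) ; complete = λ q → complete (Q⊆P q) }
    where open Traces T

  Traces-∷ : ∀ {P Q past y c₁ k₁} → Traces P past → col y ≡ c₁ → lvl y ≡ k₁ →
             (∀ {c k} → Q c k → P c k ⊎ (c ≡ c₁ × k ≡ k₁)) → (∀ {c k} → P c k → Q c k) → Q c₁ k₁ →
             Traces Q (y ∷ past)
  Traces-∷ {P} {Q} {past} {y} T refl refl Q⊆P∪y P⊆Q y∈Q = record { sound = sound′ ; complete = complete′ }
    where
    open Traces T
    sound′ : ∀ {v} → v ∈ y ∷ past → Q (col v) (lvl v)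
    sound′ (here refl) = y∈Q
    sound′ (there v∈)  = P⊆Q (sound v∈)
    complete′ : ∀ {v} → Q (col v) (lvl v) → v ∈ y ∷ past
    complete′ q with Q⊆P∪y q
    ... | inj₁ p          = there (complete p)
    ... | inj₂ (c≡ , k≡) = here (cell-≡ c≡ k≡)

  visited-at : ∀ {P past v c k} → Traces P past → col v ≡ c → lvl v ≡ k → P c k → v ∈ past
  visited-at T refl refl = Traces.complete T

  cells-at : ∀ {P past v c k} → Traces P past → v ∈ past → col v ≡ c → lvl v ≡ k → P c k
  cells-at T v∈ refl refl = Traces.sound T v∈

  open Play (Zn×Z4 n) _≟ᴳ_ using (winsNow-or-fresh) public

  play-horizontal : ∀ {past y last} → Legal last horizontal →
    ((∀ d → Legal last (vertical d) → y · elt (vertical d) ∉ past) →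
     (y · elt horizontal ∉ past) →
     Loses ((y · elt horizontal) ∷ past) (y · elt horizontal) (just horizontal)) →
    Wins past y last
  play-horizontal {past} {y} {last} legal continue
    with winsNow-or-fresh (vertical up) | winsNow-or-fresh (vertical down) | winsNow-or-fresh horizontal
  ... | inj₁ wins | _ | _ = wins
  ... | inj₂ _ | inj₁ wins | _ = wins
  ... | inj₂ _ | inj₂ _ | inj₁ wins = wins
  ... | inj₂ fresh↑ | inj₂ fresh↓ | inj₂ freshₕ =
    win-later horizontal legal (freshₕ legal) (continue fresh-vertical (freshₕ legal))
    where
    fresh-vertical : ∀ d → Legal last (vertical d) → y · elt (vertical d) ∉ past
    fresh-vertical up   = fresh↑
    fresh-vertical down = fresh↓

-- n even

module EvenGrid (n : ℕ) {{_ : NonZero n}} (n≥3 : 3 ≤ n) (n-even : parity n ≡ 0ℙ) where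
  open Grid n n≥3

  elements : List El
  elements = cartesianProduct (allFin n) (allFin 4)

  ∈-elements : ∀ v → v ∈ elements
  ∈-elements (a , b) = ∈-cartesianProduct⁺ (∈-allFin a) (∈-allFin b)

  _⊕_ : Parity × Parity → Parity × Parity → Parity × Parity
  (p , q) ⊕ (p′ , q′) = p ℙ.+ p′ , q ℙ.+ q′

  p+q+q≡p : ∀ p q → (p ℙ.+ q) ℙ.+ q ≡ p
  p+q+q≡p 0ℙ 0ℙ = refl
  p+q+q≡p 0ℙ 1ℙ = refl
  p+q+q≡p 1ℙ 0ℙ = refl
  p+q+q≡p 1ℙ 1ℙ = refl

  ⊕-cancelʳ : ∀ a b → (a ⊕ b) ⊕ b ≡ a
  ⊕-cancelʳ (p , q) (p′ , q′) = cong₂ _,_ (p+q+q≡p p p′) (p+q+q≡p q q′)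

  colour : El → Parity × Parity
  colour v = parity (col v) , parity (toℕ (lvl v))

  colour-e : colour e ≡ (0ℙ , 0ℙ)
  colour-e = cong₂ _,_ (cong parity toℕ-0ₖ) refl

  colour-· : ∀ v s → colour (v · s) ≡ colour v ⊕ colour s
  colour-· (a , b) (c , d) = cong₂ _,_ (parity-+ₖ n-even a c) (parity-+ₖ refl b d)

  colour-horizontal : colour (elt horizontal) ≡ (1ℙ , 0ℙ)
  colour-horizontal = cong₂ _,_ (cong parity (toℕ-1ₖ 1<n)) refl

  colour-gen≢o : ∀ {s} → s ∈ S → colour s ≢ (0ℙ , 0ℙ)
  colour-gen≢o (here refl) χ≡o with trans (sym colour-horizontal) χ≡o
  ... | ()
  colour-gen≢o (there (here refl)) ()

  colour-gen-injective : ∀ {s s′} → s ∈ S → s′ ∈ S → colour s ≡ colour s′ → s ≡ s′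
  colour-gen-injective (here refl)         (here refl)         _ = refl
  colour-gen-injective (there (here refl)) (there (here refl)) _ = refl
  colour-gen-injective (here refl)         (there (here refl)) χ≡ with trans (sym colour-horizontal) χ≡
  ... | ()
  colour-gen-injective (there (here refl)) (here refl)         χ≡ with trans χ≡ colour-horizontal
  ... | ()

  gen≢gen⁻¹ : ∀ {s} → s ∈ S → s ≢ inv s
  gen≢gen⁻¹ (here refl) = horizontal≢horizontal⁻¹
  gen≢gen⁻¹ (there (here refl)) s≡s⁻¹ with cong lvl s≡s⁻¹
  ... | ()

  player2-wins : Player2Wins
  player2-wins = Mirror.player2-wins (Zn×Z4 n) _≟ᴳ_ elements ∈-elements inv-involutive ·-inv-cancel
    _⊕_ (0ℙ , 0ℙ) (λ _ → refl) ⊕-cancelʳ colour colour-e colour-·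
    colour-gen≢o colour-gen-injective gen≢gen⁻¹

-- Laps around the columns

module Laps (n : ℕ) {{_ : NonZero n}} (n≥3 : 3 ≤ n) where
  open Grid n n≥3

  cellParity : ℕ → Fin 4 → Parity
  cellParity c k = parity c ℙ.+ parity (toℕ k)

  parity-shift : ∀ d k → parity (toℕ (shift d k)) ≡ parity (toℕ k) ℙ.⁻¹
  parity-shift up   0F = refl
  parity-shift up   1F = refl
  parity-shift up   2F = refl
  parity-shift up   3F = refl
  parity-shift down 0F = refl
  parity-shift down 1F = refl
  parity-shift down 2F = refl
  parity-shift down 3F = refl

  ⁻¹+⁻¹ : ∀ p q → p ℙ.⁻¹ ℙ.+ q ℙ.⁻¹ ≡ p ℙ.+ q
  ⁻¹+⁻¹ 0ℙ 0ℙ = refl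
  ⁻¹+⁻¹ 0ℙ 1ℙ = refl
  ⁻¹+⁻¹ 1ℙ 0ℙ = refl
  ⁻¹+⁻¹ 1ℙ 1ℙ = refl

  cellParity-shift : ∀ c d k → cellParity (suc c) (shift d k) ≡ cellParity c k
  cellParity-shift c d k = begin
    parity (suc c) ℙ.+ parity (toℕ (shift d k))  ≡⟨ cong₂ ℙ._+_ (sym (ℙ.suc-homo-⁻¹ (suc c))) (parity-shift d k) ⟩
    parity c ℙ.⁻¹ ℙ.+ parity (toℕ k) ℙ.⁻¹         ≡⟨ ⁻¹+⁻¹ (parity c) (parity (toℕ k)) ⟩
    parity c ℙ.+ parity (toℕ k)                  ∎
    where open ≡-Reasoning

  Adjacent : Fin 4 → Fin 4 → Set
  Adjacent k k′ = k′ ≡ k ⊎ Σ Dir λ d → k′ ≡ shift d k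

  Step : ℕ → Fin 4 → Fin 4 → Set
  Step c k k′ = Adjacent k k′ × (cellParity c k ≡ 0ℙ → k′ ≡ k)

  Step-≡ : ∀ {c k k′} → k ≡ k′ → Step c k k′
  Step-≡ k≡k′ = inj₁ (sym k≡k′) , λ _ → sym k≡k′

  record Profile (b : ℕ) (g : ℕ → Fin 4) : Set where
    field
      start : g 0 ≡ 0F
      step  : ∀ {c} → c < b → Step c (g c) (g (suc c))

  Profile-one : ∀ {b g} → Profile b g → 0 < b → g 1 ≡ 0F
  Profile-one {g = g} P 0<b = trans (proj₂ (step 0<b) (cong (λ k → parity (toℕ k)) start)) start
    where open Profile P

  extend : (ℕ → Fin 4) → ℕ → Fin 4 → ℕ → Fin 4
  extend g X v c with c ≤? X
  ... | yes _ = g c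
  ... | no _  = v

  extend-≤ : ∀ g X v {c} → c ≤ X → extend g X v c ≡ g c
  extend-≤ g X v {c} c≤X with c ≤? X
  ... | yes _  = refl
  ... | no c≰X = ⊥-elim (c≰X c≤X)

  extend-> : ∀ g X v {c} → X < c → extend g X v c ≡ v
  extend-> g X v {c} X<c with c ≤? X
  ... | yes c≤X = ⊥-elim (<⇒≱ X<c c≤X)
  ... | no _    = refl

  Profile-extend : ∀ {X g v} → Profile X g → Step X (g X) v → ∀ b → Profile b (extend g X v)
  Profile-extend {X} {g} {v} P step-X b = record
    { start = trans (extend-≤ g X v z≤n) (Profile.start P) ; step = step′ }
    where
    step′ : ∀ {c} → c < b → Step c (extend g X v c) (extend g X v (suc c))
    step′ {c} _ with <-cmp c X
    ... | tri< c<X _ _ = subst₂ (Step c) (sym (extend-≤ g X v (<⇒≤ c<X))) (sym (extend-≤ g X v c<X)) (Profile.step P c<X)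
    ... | tri≈ _ refl _ = subst₂ (Step c) (sym (extend-≤ g X v ≤-refl)) (sym (extend-> g X v ≤-refl)) step-X
    ... | tri> _ _ X<c = subst₂ (Step c) (sym (extend-> g X v X<c)) (sym (extend-> g X v (m<n⇒m<1+n X<c))) (Step-≡ {c} refl)

  -- Cells (c, g c) for c < a and (c, g (c + 1)) for c < b: in column c the path arrives at
  -- level g c and leaves at level g (c + 1).
  OnPath : ℕ → ℕ → (ℕ → Fin 4) → ℕ → Fin 4 → Set
  OnPath a b g c k = (c < a × k ≡ g c) ⊎ (c < b × k ≡ g (suc c))

  trace-agree : ∀ {X g g′ past} → (∀ {c} → c ≤ X → g′ c ≡ g c) →
                Traces (OnPath (suc X) X g) past → Traces (OnPath (suc X) X g′) past
  trace-agree {X} {g} {g′} g′≗g = Traces-resp to from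
    where
    to : ∀ {c k} → OnPath (suc X) X g c k → OnPath (suc X) X g′ c k
    to (inj₁ (c≤X , k≡)) = inj₁ (c≤X , trans k≡ (sym (g′≗g (≤-pred c≤X))))
    to (inj₂ (c<X , k≡)) = inj₂ (c<X , trans k≡ (sym (g′≗g c<X)))
    from : ∀ {c k} → OnPath (suc X) X g′ c k → OnPath (suc X) X g c k
    from (inj₁ (c≤X , k≡)) = inj₁ (c≤X , trans k≡ (g′≗g (≤-pred c≤X)))
    from (inj₂ (c<X , k≡)) = inj₂ (c<X , trans k≡ (g′≗g c<X))

  leave-⊆ : ∀ {X g c k} → OnPath (suc X) (suc X) g c k → OnPath (suc X) X g c k ⊎ (c ≡ X × k ≡ g (suc X))
  leave-⊆ (inj₁ on-entry) = inj₁ (inj₁ on-entry)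
  leave-⊆ (inj₂ (c<X+1 , k≡)) with m<1+n⇒m<n∨m≡n c<X+1
  ... | inj₁ c<X  = inj₁ (inj₂ (c<X , k≡))
  ... | inj₂ refl = inj₂ (refl , k≡)

  leave-⊇ : ∀ {X g c k} → OnPath (suc X) X g c k → OnPath (suc X) (suc X) g c k
  leave-⊇ (inj₁ on-entry)     = inj₁ on-entry
  leave-⊇ (inj₂ (c<X , k≡)) = inj₂ (m<n⇒m<1+n c<X , k≡)

  trace-leave : ∀ {X g past y} → Traces (OnPath (suc X) X g) past → col y ≡ X → lvl y ≡ g (suc X) →
                Traces (OnPath (suc X) (suc X) g) (y ∷ past)
  trace-leave {X} {g} T col-y lvl-y =
    Traces-∷ T col-y lvl-y (leave-⊆ {X} {g}) (leave-⊇ {X} {g}) (inj₂ (≤-refl , refl))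

  trace-stay : ∀ {X g past} → g (suc X) ≡ g X →
               Traces (OnPath (suc X) X g) past → Traces (OnPath (suc X) (suc X) g) past
  trace-stay {X} {g} flat = Traces-resp (leave-⊇ {X} {g}) stay-⊆
    where
    stay-⊆ : ∀ {c k} → OnPath (suc X) (suc X) g c k → OnPath (suc X) X g c k
    stay-⊆ q with leave-⊆ {X} {g} q
    ... | inj₁ on-path       = on-path
    ... | inj₂ (refl , k≡) = inj₁ (≤-refl , trans k≡ flat)

  trace-enter : ∀ {X g past y} → Traces (OnPath (suc X) (suc X) g) past → col y ≡ suc X → lvl y ≡ g (suc X) →
                Traces (OnPath (suc (suc X)) (suc X) g) (y ∷ past)
  trace-enter {X} {g} T col-y lvl-y = Traces-∷ T col-y lvl-y enter-⊆ enter-⊇ (inj₁ (≤-refl , refl))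
    where
    enter-⊆ : ∀ {c k} → OnPath (suc (suc X)) (suc X) g c k →
              OnPath (suc X) (suc X) g c k ⊎ (c ≡ suc X × k ≡ g (suc X))
    enter-⊆ (inj₁ (c<X+2 , k≡)) with m<1+n⇒m<n∨m≡n c<X+2
    ... | inj₁ c<X+1 = inj₁ (inj₁ (c<X+1 , k≡))
    ... | inj₂ refl  = inj₂ (refl , k≡)
    enter-⊆ (inj₂ on-exit) = inj₁ (inj₂ on-exit)
    enter-⊇ : ∀ {c k} → OnPath (suc X) (suc X) g c k → OnPath (suc (suc X)) (suc X) g c k
    enter-⊇ (inj₁ (c<X+1 , k≡)) = inj₁ (m<n⇒m<1+n c<X+1 , k≡)
    enter-⊇ (inj₂ on-exit) = inj₂ on-exit

  SecondLapCells : (ℕ → Fin 4) → ℕ → ℕ → Fin 4 → Set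
  SecondLapCells g b c k = OnPath n n g c k ⊎ (c < b × k ≡ 2F)

  trace-secondLap-start : ∀ {g past} → Traces (OnPath n n g) past → Traces (SecondLapCells g 0) past
  trace-secondLap-start = Traces-resp inj₁ λ { (inj₁ on-path) → on-path ; (inj₂ (() , _)) }

  trace-secondLap : ∀ {g b past y} → Traces (SecondLapCells g b) past → col y ≡ b → lvl y ≡ 2F →
                    Traces (SecondLapCells g (suc b)) (y ∷ past)
  trace-secondLap {g} {b} T col-y lvl-y = Traces-∷ T col-y lvl-y lap-⊆ lap-⊇ (inj₂ (≤-refl , refl))
    where
    lap-⊆ : ∀ {c k} → SecondLapCells g (suc b) c k → SecondLapCells g b c k ⊎ (c ≡ b × k ≡ 2F)
    lap-⊆ (inj₁ on-path) = inj₁ (inj₁ on-path)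
    lap-⊆ (inj₂ (c<b+1 , k≡)) with m<1+n⇒m<n∨m≡n c<b+1
    ... | inj₁ c<b = inj₁ (inj₂ (c<b , k≡))
    ... | inj₂ c≡b = inj₂ (c≡b , k≡)
    lap-⊇ : ∀ {c k} → SecondLapCells g b c k → SecondLapCells g (suc b) c k
    lap-⊇ (inj₁ on-path) = inj₁ on-path
    lap-⊇ (inj₂ (c<b , k≡)) = inj₂ (m<n⇒m<1+n c<b , k≡)

  shift-≢ : ∀ d k → shift d k ≢ k
  shift-≢ up   0F ()
  shift-≢ up   1F ()
  shift-≢ up   2F ()
  shift-≢ up   3F ()
  shift-≢ down 0F ()
  shift-≢ down 1F ()
  shift-≢ down 2F ()
  shift-≢ down 3F ()

  2F≢0F : _≢_ {A = Fin 4} 2F 0F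
  2F≢0F ()

  shift-2F≢0F : ∀ d → shift d 2F ≢ 0F
  shift-2F≢0F up   ()
  shift-2F≢0F down ()

  shift-shift-2F : ∀ d → shift d (shift d 2F) ≡ 0F
  shift-shift-2F up   = refl
  shift-shift-2F down = refl

  opposite : Dir → Dir
  opposite up   = down
  opposite down = up

  shift-0F : ∀ d → shift d 0F ≡ shift (opposite d) 2F
  shift-0F up   = refl
  shift-0F down = refl

  Adjacent-0F-≢2F : ∀ {k} → Adjacent 0F k → k ≢ 2F
  Adjacent-0F-≢2F (inj₁ refl) ()
  Adjacent-0F-≢2F (inj₂ (up , refl)) ()
  Adjacent-0F-≢2F (inj₂ (down , refl)) ()

  even-level : (k : Fin 4) → parity (toℕ k) ≡ 0ℙ → k ≡ 0F ⊎ k ≡ 2F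
  even-level 0F _ = inj₁ refl
  even-level 2F _ = inj₂ refl
  even-level 1F ()
  even-level 3F ()

  odd-level : (k : Fin 4) → parity (toℕ k) ≡ 1ℙ → Σ Dir λ d → shift d k ≡ 0F
  odd-level 1F _ = down , refl
  odd-level 3F _ = up , refl
  odd-level 0F ()
  odd-level 2F ()

  level-parity : ∀ c k → cellParity c k ≡ 1ℙ → parity (toℕ k) ≡ parity c ℙ.⁻¹
  level-parity c k with parity c | parity (toℕ k)
  ... | 0ℙ | 1ℙ = λ _ → refl
  ... | 1ℙ | 0ℙ = λ _ → refl
  ... | 0ℙ | 0ℙ = λ ()
  ... | 1ℙ | 1ℙ = λ ()

  record SecondLap (c₀ : ℕ) (g : ℕ → Fin 4) (past : List El) (w : El) : Set where
    field
      c₀+1<n  : suc c₀ < n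
      c₀-even : parity c₀ ≡ 0ℙ
      profile : Profile n g
      exit    : g n ≡ 2F
      low     : ∀ {c} → c ≤ suc c₀ → g c ≡ 0F
      traces  : Traces (SecondLapCells g (suc c₀)) past
      col-w   : col w ≡ c₀
      lvl-w   : lvl w ≡ 2F

  secondLap-start : ∀ {g past z} → Profile n g → g n ≡ 2F → Traces (OnPath n n g) past →
                    col z ≡ 0 → lvl z ≡ 2F → SecondLap 0 g (z ∷ past) z
  secondLap-start {g} P exit T col-z lvl-z = record
    { c₀+1<n = 1<n ; c₀-even = refl ; profile = P ; exit = exit ; low = low
    ; traces = trace-secondLap (trace-secondLap-start T) col-z lvl-z ; col-w = col-z ; lvl-w = lvl-z }
    where
    low : ∀ {c} → c ≤ 1 → g c ≡ 0F
    low z≤n       = Profile.start P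
    low (s≤s z≤n) = Profile-one P (>-nonZero⁻¹ n)

  below-exit : (g : ℕ → Fin 4) {c : ℕ} → g n ≡ 2F → c ≤ n → g c ≡ 0F → c < n
  below-exit g exit c≤n gc≡0F with m≤n⇒m<n∨m≡n c≤n
  ... | inj₁ c<n  = c<n
  ... | inj₂ refl = ⊥-elim (2F≢0F (trans (sym exit) gc≡0F))

  secondLap-turn-refuted : ∀ {c₀ g past w} → SecondLap c₀ g past w →
                   ∀ d (t : Move) → elt t ≡ elt (vertical d) → Refuted past w t
  secondLap-turn-refuted {c₀} {g} {past} {w} L d t t≡v = fresh , win-now (vertical d) legal back-to-level-0
    where
    open SecondLap L
    y = w · elt t
    col-y : col y ≡ c₀
    col-y = trans (cong (λ s → col (w · s)) t≡v) (trans (col-vertical d w) col-w)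
    lvl-y : lvl y ≡ shift d 2F
    lvl-y = trans (cong (λ s → lvl (w · s)) t≡v) (trans (lvl-vertical d w) (cong (shift d) lvl-w))
    fresh : y ∉ past
    fresh y∈ with cells-at traces y∈ col-y lvl-y
    ... | inj₁ (inj₁ (_ , k≡)) = shift-2F≢0F d (trans k≡ (low (n≤1+n c₀)))
    ... | inj₁ (inj₂ (_ , k≡)) = shift-2F≢0F d (trans k≡ (low ≤-refl))
    ... | inj₂ (_ , k≡)        = shift-≢ d 2F k≡
    legal : Legal (just t) (vertical d)
    legal = legal-after t (vertical d) t≡v (vertical≢vertical⁻¹ d)
    back-to-level-0 : y · elt (vertical d) ∈ y ∷ past
    back-to-level-0 = there (visited-at traces (trans (col-vertical d y) col-y)
      (trans (lvl-vertical d y) (trans (cong (shift d) lvl-y) (shift-shift-2F d)))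
      (inj₁ (inj₁ (<-trans (n<1+n c₀) c₀+1<n , sym (low (n≤1+n c₀))))))

  secondLap-advance : ∀ {c₀ g past w y z} → SecondLap c₀ g past w → g (suc (suc c₀)) ≡ 0F →
                      col y ≡ suc c₀ → lvl y ≡ 2F → col z ≡ suc (suc c₀) → lvl z ≡ 2F →
                      SecondLap (suc (suc c₀)) g (z ∷ y ∷ past) z
  secondLap-advance {c₀} {g} L g₂≡0F col-y lvl-y col-z lvl-z = record
    { c₀+1<n = below-exit g exit c₀+2<n g₃≡0F ; c₀-even = c₀-even ; profile = profile ; exit = exit
    ; low = low′ ; traces = trace-secondLap (trace-secondLap traces col-y lvl-y) col-z lvl-z
    ; col-w = col-z ; lvl-w = lvl-z }
    where
    open SecondLap L
    c₀+2<n : suc (suc c₀) < n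
    c₀+2<n = below-exit g exit c₀+1<n g₂≡0F
    g₃≡0F : g (suc (suc (suc c₀))) ≡ 0F
    g₃≡0F = trans (proj₂ (Profile.step profile c₀+2<n) even-cell) g₂≡0F
      where
      even-cell : cellParity (suc (suc c₀)) (g (suc (suc c₀))) ≡ 0ℙ
      even-cell = trans (cong (λ k → parity c₀ ℙ.+ parity (toℕ k)) g₂≡0F) (cong (ℙ._+ 0ℙ) c₀-even)
    low′ : ∀ {c} → c ≤ suc (suc (suc c₀)) → g c ≡ 0F
    low′ c≤ with m≤n⇒m<n∨m≡n c≤
    ... | inj₂ refl = g₃≡0F
    ... | inj₁ (s≤s c≤c₀+2) with m≤n⇒m<n∨m≡n c≤c₀+2
    ...   | inj₂ refl           = g₂≡0F
    ...   | inj₁ (s≤s c≤c₀+1)   = low c≤c₀+1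

  secondLap-again-refuted : ∀ {c₀ g past w} →
    (∀ {past′ z} → SecondLap (suc (suc c₀)) g past′ z → Loses past′ z (just horizontal)) →
    SecondLap c₀ g past w → (t : Move) → elt t ≡ elt horizontal → Refuted past w t
  secondLap-again-refuted {c₀} {g} {past} {w} next-loses L t t≡h =
    fresh , play-horizontal (legal-after t horizontal t≡h horizontal≢horizontal⁻¹) continue
    where
    open SecondLap L
    y = w · elt t
    col-y : col y ≡ suc c₀
    col-y = trans (cong (λ s → col (w · s)) t≡h) (col-horizontal-< w col-w c₀+1<n)
    lvl-y : lvl y ≡ 2F
    lvl-y = trans (cong (λ s → lvl (w · s)) t≡h) (trans (lvl-horizontal w) lvl-w)
    adjacent : Adjacent 0F (g (suc (suc c₀)))
    adjacent = subst (λ k → Adjacent k (g (suc (suc c₀)))) (low ≤-refl) (proj₁ (Profile.step profile c₀+1<n))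
    fresh : y ∉ past
    fresh y∈ with cells-at traces y∈ col-y lvl-y
    ... | inj₁ (inj₁ (_ , 2F≡)) = 2F≢0F (trans 2F≡ (low ≤-refl))
    ... | inj₁ (inj₂ (_ , 2F≡)) = Adjacent-0F-≢2F adjacent (sym 2F≡)
    ... | inj₂ (c₀+1<c₀+1 , _)  = <-irrefl refl c₀+1<c₀+1
    continue : (∀ d → Legal (just t) (vertical d) → y · elt (vertical d) ∉ y ∷ past) →
               y · elt horizontal ∉ y ∷ past →
               Loses ((y · elt horizontal) ∷ y ∷ past) (y · elt horizontal) (just horizontal)
    continue fresh-vertical _ = next-loses
      (secondLap-advance L g₂≡0F col-y lvl-y (col-horizontal-< y col-y c₀+2<n)
                         (trans (lvl-horizontal y) lvl-y))
      where
      -- Were the first lap to leave column c₀ + 1 at level 1 or 3, Player 1 would now step onto it.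
      g₂≡0F : g (suc (suc c₀)) ≡ 0F
      g₂≡0F with adjacent
      ... | inj₁ g₂≡0F = g₂≡0F
      ... | inj₂ (d , g₂≡shift) = ⊥-elim (fresh-vertical (opposite d)
              (legal-after t (vertical (opposite d)) t≡h (vertical≢horizontal⁻¹ (opposite d)))
              (there (visited-at traces (trans (col-vertical (opposite d) y) col-y)
                (trans (lvl-vertical (opposite d) y) (trans (cong (shift (opposite d)) lvl-y)
                  (trans (sym (shift-0F d)) (sym g₂≡shift))))
                (inj₁ (inj₂ (c₀+1<n , refl))))))
      c₀+2<n : suc (suc c₀) < n
      c₀+2<n = below-exit g exit c₀+1<n g₂≡0F

  secondLap-loses : ∀ fuel {c₀ g past w} → n ≤ c₀ + fuel → SecondLap c₀ g past w →
                    Loses past w (just horizontal)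
  secondLap-loses zero {c₀} bound L =
    ⊥-elim (<⇒≱ (<-trans (n<1+n c₀) (SecondLap.c₀+1<n L)) (subst (n ≤_) (+-identityʳ c₀) bound))
  secondLap-loses (suc fuel) {c₀} {g} {past} {w} bound L = lose λ t legal → respond t (after-horizontal t legal)
    where
    respond : (t : Move) → AfterHorizontal t → Refuted past w t
    respond t (turn d t≡v) = secondLap-turn-refuted L d t t≡v
    respond t (again t≡h) = secondLap-again-refuted (secondLap-loses fuel bound′) L t t≡h
      where
      bound′ : n ≤ suc (suc c₀) + fuel
      bound′ = ≤-trans bound (≤-trans (≤-reflexive (+-suc c₀ fuel)) (n≤1+n _))

  record FirstLap (X : ℕ) (g : ℕ → Fin 4) (past : List El) (w : El) : Set where
    field
      X<n      : X < n
      profile  : Profile X g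
      traces   : Traces (OnPath (suc X) X g) past
      col-w    : col w ≡ X
      lvl-w    : lvl w ≡ g X
      odd-cell : cellParity X (g X) ≡ 1ℙ

  wrap-into-secondLap : ∀ {X g past z} → suc X ≡ n → Profile n g → Traces (OnPath (suc X) (suc X) g) past →
                        parity (toℕ (g (suc X))) ≡ 0ℙ → col z ≡ 0 → lvl z ≡ g (suc X) → z ∉ past →
                        Loses (z ∷ past) z (just horizontal)
  wrap-into-secondLap {X} {g} {past} X+1≡n P T even col-z lvl-z z∉ with even-level (g (suc X)) even
  ... | inj₁ ≡0F = ⊥-elim (z∉ (visited-at T col-z (trans lvl-z ≡0F) (inj₁ (s≤s z≤n , sym (Profile.start P)))))
  ... | inj₂ ≡2F = secondLap-loses n ≤-refl
        (secondLap-start P (subst (λ m → g m ≡ 2F) X+1≡n ≡2F) (subst (λ m → Traces (OnPath m m g) past) X+1≡n T)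
                         col-z (trans lvl-z ≡2F))

  turn-step : ∀ {X g past w} → FirstLap X g past w → ∀ d → Step X (g X) (shift d (g X))
  turn-step F d = inj₂ (d , refl) , λ even → ⊥-elim (ℙ.p≢p⁻¹ 1ℙ (trans (sym (FirstLap.odd-cell F)) even))

  turned-traces : ∀ {X g past w y} → FirstLap X g past w → ∀ d → col y ≡ X → lvl y ≡ shift d (g X) →
                  Traces (OnPath (suc X) (suc X) (extend g X (shift d (g X)))) (y ∷ past)
  turned-traces {X} {g} F d col-y lvl-y =
    trace-leave (trace-agree (extend-≤ g X v) (FirstLap.traces F)) col-y (trans lvl-y (sym (extend-> g X v ≤-refl)))
    where v = shift d (g X)

  firstLap-turned : ∀ {X g past w y z} → FirstLap X g past w → ∀ d → suc X < n →
                    col y ≡ X → lvl y ≡ shift d (g X) → col z ≡ suc X → lvl z ≡ shift d (g X) →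
                    FirstLap (suc X) (extend g X (shift d (g X))) (z ∷ y ∷ past) z
  firstLap-turned {X} {g} F d X+1<n col-y lvl-y col-z lvl-z = record
    { X<n = X+1<n ; profile = Profile-extend profile (turn-step F d) (suc X)
    ; traces = trace-enter (turned-traces F d col-y lvl-y) col-z (trans lvl-z (sym v-after))
    ; col-w = col-z ; lvl-w = trans lvl-z (sym v-after)
    ; odd-cell = trans (cong (cellParity (suc X)) v-after) (trans (cellParity-shift X d (g X)) odd-cell) }
    where
    open FirstLap F
    v-after : extend g X (shift d (g X)) (suc X) ≡ shift d (g X)
    v-after = extend-> g X (shift d (g X)) ≤-refl

  straight-traces : ∀ {X g past w y} → FirstLap X g past w → col y ≡ suc X → lvl y ≡ g X →
                    Traces (OnPath (suc (suc X)) (suc (suc X)) (extend g X (g X))) (y ∷ past)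
  straight-traces {X} {g} F col-y lvl-y =
    trace-stay (trans (flat (s≤s (n≤1+n X))) (sym (flat ≤-refl)))
      (trace-enter (trace-stay (trans (flat ≤-refl) (sym (extend-≤ g X (g X) ≤-refl)))
                                (trace-agree (extend-≤ g X (g X)) (FirstLap.traces F)))
                   col-y (trans lvl-y (sym (flat ≤-refl))))
    where
    flat : ∀ {c} → X < c → extend g X (g X) c ≡ g X
    flat = extend-> g X (g X)

  firstLap-straight : ∀ {X g past w y z} → FirstLap X g past w → suc (suc X) < n →
                      col y ≡ suc X → lvl y ≡ g X → col z ≡ suc (suc X) → lvl z ≡ g X →
                      FirstLap (suc (suc X)) (extend g X (g X)) (z ∷ y ∷ past) z
  firstLap-straight {X} {g} F X+2<n col-y lvl-y col-z lvl-z = record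
    { X<n = X+2<n ; profile = Profile-extend profile (Step-≡ {X} refl) (suc (suc X))
    ; traces = trace-enter (straight-traces F col-y lvl-y) col-z (trans lvl-z (sym (flat (s≤s (n≤1+n X)))))
    ; col-w = col-z ; lvl-w = trans lvl-z (sym (flat (s≤s (n≤1+n X))))
    ; odd-cell = trans (cong (cellParity X) (flat (s≤s (n≤1+n X)))) odd-cell }
    where
    open FirstLap F
    flat : ∀ {c} → X < c → extend g X (g X) c ≡ g X
    flat = extend-> g X (g X)

-- n odd

module OddGrid (n : ℕ) {{_ : NonZero n}} (n≥3 : 3 ≤ n) (n-odd : parity n ≡ 1ℙ) where
  open Grid n n≥3
  open Laps n n≥3

  last-column-even : ∀ {X} → suc X ≡ n → parity X ≡ 0ℙ
  last-column-even {X} X+1≡n = trans (sym (ℙ.suc-homo-⁻¹ X)) (cong ℙ._⁻¹ (trans (cong parity X+1≡n) n-odd))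

  penultimate-column-odd : ∀ {X} → suc (suc X) ≡ n → parity X ≡ 1ℙ
  penultimate-column-odd X+2≡n = trans (cong parity X+2≡n) n-odd

  firstLap-wrap-refuted : ∀ {X g past w} → FirstLap X g past w → suc X ≡ n →
                          (t : Move) → elt t ≡ elt horizontal → Refuted past w t
  firstLap-wrap-refuted {X} {g} {past} {w} F X+1≡n t t≡h =
    fresh , win-now (vertical d) (legal-after t (vertical d) t≡h (vertical≢horizontal⁻¹ d)) (there back-to-start)
    where
    open FirstLap F
    odd-level-X : parity (toℕ (g X)) ≡ 1ℙ
    odd-level-X = trans (level-parity X (g X) odd-cell) (cong ℙ._⁻¹ (last-column-even X+1≡n))
    d : Dir
    d = proj₁ (odd-level (g X) odd-level-X)
    shift≡0F : shift d (g X) ≡ 0F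
    shift≡0F = proj₂ (odd-level (g X) odd-level-X)
    y = w · elt t
    col-y : col y ≡ 0
    col-y = trans (cong (λ s → col (w · s)) t≡h) (col-horizontal-wrap w col-w X+1≡n)
    lvl-y : lvl y ≡ g X
    lvl-y = trans (cong (λ s → lvl (w · s)) t≡h) (trans (lvl-horizontal w) lvl-w)
    g-X≢0F : g X ≢ 0F
    g-X≢0F g-X≡0F = shift-≢ d 0F (trans (cong (shift d) (sym g-X≡0F)) shift≡0F)
    fresh : y ∉ past
    fresh y∈ with cells-at traces y∈ col-y lvl-y
    ... | inj₁ (_ , k≡)   = g-X≢0F (trans k≡ (Profile.start profile))
    ... | inj₂ (0<X , k≡) = g-X≢0F (trans k≡ (Profile-one profile 0<X))
    back-to-start : y · elt (vertical d) ∈ past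
    back-to-start = visited-at traces (trans (col-vertical d y) col-y)
      (trans (lvl-vertical d y) (trans (cong (shift d) lvl-y) shift≡0F)) (inj₁ (s≤s z≤n , sym (Profile.start profile)))

  firstLap-turn-refuted : ∀ {X g past w} →
    (∀ {g′ past′ z} → FirstLap (suc X) g′ past′ z → Loses past′ z (just horizontal)) →
    FirstLap X g past w → ∀ d (t : Move) → elt t ≡ elt (vertical d) → Refuted past w t
  firstLap-turn-refuted {X} {g} {past} {w} next-loses F d t t≡v =
    fresh , play-horizontal (legal-after t horizontal t≡v (horizontal≢vertical⁻¹ d)) continue
    where
    open FirstLap F
    y = w · elt t
    col-y : col y ≡ X
    col-y = trans (cong (λ s → col (w · s)) t≡v) (trans (col-vertical d w) col-w)
    lvl-y : lvl y ≡ shift d (g X)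
    lvl-y = trans (cong (λ s → lvl (w · s)) t≡v) (trans (lvl-vertical d w) (cong (shift d) lvl-w))
    fresh : y ∉ past
    fresh y∈ with cells-at traces y∈ col-y lvl-y
    ... | inj₁ (_ , k≡)  = shift-≢ d (g X) k≡
    ... | inj₂ (X<X , _) = <-irrefl refl X<X
    continue : (∀ d′ → Legal (just t) (vertical d′) → y · elt (vertical d′) ∉ y ∷ past) →
               y · elt horizontal ∉ y ∷ past →
               Loses ((y · elt horizontal) ∷ y ∷ past) (y · elt horizontal) (just horizontal)
    continue _ fresh-h with m≤n⇒m<n∨m≡n X<n
    ... | inj₁ X+1<n = next-loses
          (firstLap-turned F d X+1<n col-y lvl-y (col-horizontal-< y col-y X+1<n) (trans (lvl-horizontal y) lvl-y))
    ... | inj₂ X+1≡n = wrap-into-secondLap X+1≡n (Profile-extend profile (turn-step F d) n)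
          (turned-traces F d col-y lvl-y) even (col-horizontal-wrap y col-y X+1≡n)
          (trans (lvl-horizontal y) (trans lvl-y (sym v-after))) fresh-h
      where
      v-after : extend g X (shift d (g X)) (suc X) ≡ shift d (g X)
      v-after = extend-> g X (shift d (g X)) ≤-refl
      even : parity (toℕ (extend g X (shift d (g X)) (suc X))) ≡ 0ℙ
      even = trans (cong (λ k → parity (toℕ k)) v-after) (trans (parity-shift d (g X))
               (cong ℙ._⁻¹ (trans (level-parity X (g X) odd-cell) (cong ℙ._⁻¹ (last-column-even X+1≡n)))))

  firstLap-again-refuted : ∀ {X g past w} → suc X < n →
    (∀ {g′ past′ z} → FirstLap (suc (suc X)) g′ past′ z → Loses past′ z (just horizontal)) →
    FirstLap X g past w → (t : Move) → elt t ≡ elt horizontal → Refuted past w t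
  firstLap-again-refuted {X} {g} {past} {w} X+1<n next-loses F t t≡h =
    fresh , play-horizontal (legal-after t horizontal t≡h horizontal≢horizontal⁻¹) continue
    where
    open FirstLap F
    y = w · elt t
    col-y : col y ≡ suc X
    col-y = trans (cong (λ s → col (w · s)) t≡h) (col-horizontal-< w col-w X+1<n)
    lvl-y : lvl y ≡ g X
    lvl-y = trans (cong (λ s → lvl (w · s)) t≡h) (trans (lvl-horizontal w) lvl-w)
    fresh : y ∉ past
    fresh y∈ with cells-at traces y∈ col-y lvl-y
    ... | inj₁ (X+1<X+1 , _) = <-irrefl refl X+1<X+1
    ... | inj₂ (X+1<X , _)   = <⇒≱ X+1<X (n≤1+n X)
    continue : (∀ d → Legal (just t) (vertical d) → y · elt (vertical d) ∉ y ∷ past) →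
               y · elt horizontal ∉ y ∷ past →
               Loses ((y · elt horizontal) ∷ y ∷ past) (y · elt horizontal) (just horizontal)
    continue _ fresh-h with m≤n⇒m<n∨m≡n X+1<n
    ... | inj₁ X+2<n = next-loses
          (firstLap-straight F X+2<n col-y lvl-y (col-horizontal-< y col-y X+2<n) (trans (lvl-horizontal y) lvl-y))
    ... | inj₂ X+2≡n = wrap-into-secondLap X+2≡n (Profile-extend profile (Step-≡ {X} refl) n)
          (straight-traces F col-y lvl-y) even (col-horizontal-wrap y col-y X+2≡n)
          (trans (lvl-horizontal y) (trans lvl-y (sym flat))) fresh-h
      where
      flat : extend g X (g X) (suc (suc X)) ≡ g X
      flat = extend-> g X (g X) (s≤s (n≤1+n X))
      even : parity (toℕ (extend g X (g X) (suc (suc X)))) ≡ 0ℙ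
      even = trans (cong (λ k → parity (toℕ k)) flat)
               (trans (level-parity X (g X) odd-cell) (cong ℙ._⁻¹ (penultimate-column-odd X+2≡n)))

  firstLap-loses : ∀ fuel {X g past w} → n ≤ X + fuel → FirstLap X g past w →
                   Loses past w (just horizontal)
  firstLap-loses zero {X} bound F = ⊥-elim (<⇒≱ (FirstLap.X<n F) (subst (n ≤_) (+-identityʳ X) bound))
  firstLap-loses (suc fuel) {X} {g} {past} {w} bound F = lose λ t legal → respond t (after-horizontal t legal)
    where
    bound′ : n ≤ suc X + fuel
    bound′ = ≤-trans bound (≤-reflexive (+-suc X fuel))
    respond : (t : Move) → AfterHorizontal t → Refuted past w t
    respond t (turn d t≡v) = firstLap-turn-refuted (firstLap-loses fuel bound′) F d t t≡v
    respond t (again t≡h) with m≤n⇒m<n∨m≡n (FirstLap.X<n F)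
    ... | inj₂ X+1≡n = firstLap-wrap-refuted F X+1≡n t t≡h
    ... | inj₁ X+1<n = firstLap-again-refuted X+1<n (firstLap-loses fuel (≤-trans bound′ (n≤1+n _))) F t t≡h

  player1-wins : Player1Wins
  player1-wins = win-later horizontal _ fresh (firstLap-loses n (n≤1+n n) initial)
    where
    w = e · elt horizontal
    col-e : col e ≡ 0
    col-e = toℕ-0ₖ
    col-w : col w ≡ 1
    col-w = col-horizontal-< e col-e 1<n
    fresh : w ∉ e ∷ []
    fresh (here w≡e) with trans (sym col-w) (trans (cong col w≡e) col-e)
    ... | ()
    level-0 : ℕ → Fin 4
    level-0 _ = 0F
    start : Traces (OnPath 1 0 level-0) (e ∷ [])
    start = record { sound = sound ; complete = complete }
      where
      sound : ∀ {v} → v ∈ e ∷ [] → OnPath 1 0 level-0 (col v) (lvl v)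
      sound (here refl) = inj₁ (subst (_< 1) (sym col-e) (s≤s z≤n) , refl)
      complete : ∀ {v} → OnPath 1 0 level-0 (col v) (lvl v) → v ∈ e ∷ []
      complete (inj₁ (c<1 , k≡)) = here (cell-≡ (trans (n<1⇒n≡0 c<1) (sym col-e)) k≡)
    initial : FirstLap 1 level-0 (w ∷ e ∷ []) w
    initial = record
      { X<n = 1<n ; profile = record { start = refl ; step = λ {c} _ → Step-≡ {c} refl }
      ; traces = trace-enter (trace-stay refl start) col-w (lvl-horizontal e)
      ; col-w = col-w ; lvl-w = lvl-horizontal e ; odd-cell = refl }

parity-mod-4 : ∀ n → parity n ≡ parity (n % 4)
parity-mod-4 n = sym (parity-% refl n)

proposition5p3 : (n : ℕ) {{_ : NonZero n}} → 3 ≤ n →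
    ((n % 4 ≡ 1 ⊎ n % 4 ≡ 3) → REL.Player1Wins (Zn×Z4 n)) ×
    ((n % 4 ≡ 0 ⊎ n % 4 ≡ 2) → REL.Player2Wins (Zn×Z4 n))
proposition5p3 n n≥3 = player1 , player2
  where
  player1 : (n % 4 ≡ 1 ⊎ n % 4 ≡ 3) → REL.Player1Wins (Zn×Z4 n)
  player1 (inj₁ n≡1) = OddGrid.player1-wins n n≥3 (trans (parity-mod-4 n) (cong parity n≡1))
  player1 (inj₂ n≡3) = OddGrid.player1-wins n n≥3 (trans (parity-mod-4 n) (cong parity n≡3))
  player2 : (n % 4 ≡ 0 ⊎ n % 4 ≡ 2) → REL.Player2Wins (Zn×Z4 n)
  player2 (inj₁ n≡0) = EvenGrid.player2-wins n n≥3 (trans (parity-mod-4 n) (cong parity n≡0))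
  player2 (inj₂ n≡2) = EvenGrid.player2-wins n n≥3 (trans (parity-mod-4 n) (cong parity n≡2))
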